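{- Let $G$ be a complete wheel with $n\geq6$ vertices, cycle $C=\{c_1,\dots,c_{n-1}\}$ and central vertex $h$, and let $k\in\{3,4\}$. Any set $X\subseteq V$ satisfying the condition "for every $i$, if $c_i\notin X$ then $c_{i-2},c_{i-1},c_{i+1},c_{i+2}\in X$" contains at least $\lfloor 2n/3\rfloor$ cycle vertices. Furthermore, if $L\subseteq V$ satisfies $|L\cap C|\geq k+2$, then for every $i$ the pair $h,c_i$ is separated by at least $k$ vertices of $L\cap C$; and in this case, if $L$ is an NL-landmark set for parameter $k$, then $L\setminus\{h\}$ is also an NL-landmark set for parameter $k$.
   Context: The complete wheel on $n$ vertices has vertex set $V=C\cup\{h\}$ with $C=\{c_1,\dots,c_{n-1}\}$, edges $\{c_i,h\}$ and $\{c_i,c_{i+1}\}$ for $1\le i\le n-1$, indices modulo $n-1$. $d(x,y)$ denotes graph distance; $\tau$ separates distinct $u,v$ if $d(u,\tau)\neq d(v,\tau)$. $L\subseteq V$ is an NL-landmark set for parameter $k$ if every pair of distinct $u,v\in V\setminus L$ is separated by at least $k$ distinct vertices of $L$. -}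

module Defs where

open import Data.Nat using (ℕ; zero; suc; _+_; _∸_; _<_)
open import Data.Fin using (Fin; toℕ)
open import Data.Bool using (Bool; true; false; _∧_; not)
open import Data.Product using (Σ; _×_; ∃; ∃-syntax)
open import Data.Sum using (_⊎_)
open import Relation.Binary.PropositionalEquality using (_≡_; _≢_)
open import Relation.Nullary using (¬_)
open import Function.Definitions using (Injective)
open import Data.Empty using (⊥)
open import Data.Unit using (⊤)

-- Vertices of the complete wheel on n vertices: the hub h and the
-- cycle vertices c_1,…,c_{n-1}, represented by cyc i with i : Fin (n ∸ 1)
-- (c_{i+1} ↔ cyc i).
data Vtx (n : ℕ) : Set where
  hub : Vtx n
  cyc : Fin (n ∸ 1) → Vtx n

Succ : (n : ℕ) → Fin (n ∸ 1) → Fin (n ∸ 1) → Set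
Succ n i j = (suc (toℕ i) ≡ toℕ j) ⊎ ((suc (toℕ i) ≡ n ∸ 1) × (toℕ j ≡ 0))

Succ2 : (n : ℕ) → Fin (n ∸ 1) → Fin (n ∸ 1) → Set
Succ2 n i j = ∃[ l ] (Succ n i l × Succ n l j)

Adj : (n : ℕ) → Vtx n → Vtx n → Set
Adj n hub hub = ⊥
Adj n hub (cyc j) = ⊤
Adj n (cyc i) hub = ⊤
Adj n (cyc i) (cyc j) = Succ n i j ⊎ Succ n j i

data Walk (n : ℕ) : Vtx n → Vtx n → ℕ → Set where
  here : ∀ {u} → Walk n u u 0
  step : ∀ {u w v t} → Adj n u w → Walk n w v t → Walk n u v (suc t)

Dist : (n : ℕ) → Vtx n → Vtx n → ℕ → Set
Dist n u v t = Walk n u v t × (∀ s → s < t → ¬ Walk n u v s)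

Separates : (n : ℕ) → Vtx n → Vtx n → Vtx n → Set
Separates n τ u v = ∃[ a ] ∃[ b ] (Dist n u τ a × Dist n v τ b × a ≢ b)

VSet : ℕ → Set
VSet n = Vtx n → Bool

_∈_ : ∀ {n} → Vtx n → VSet n → Set
v ∈ S = S v ≡ true

_∉_ : ∀ {n} → Vtx n → VSet n → Set
v ∉ S = S v ≡ false

isHub : ∀ {n} → Vtx n → Bool
isHub hub = true
isHub (cyc _) = false

removeHub : ∀ {n} → VSet n → VSet n
removeHub L v = L v ∧ not (isHub v)

AtLeastCyc : (n : ℕ) → ℕ → VSet n → Set
AtLeastCyc n r S =
  Σ (Fin r → Fin (n ∸ 1)) λ f → Injective _≡_ _≡_ f × (∀ j → cyc (f j) ∈ S)

CondX : (n : ℕ) → VSet n → Set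
CondX n X = ∀ i → cyc i ∉ X → ∀ j →
  (Succ n i j ⊎ Succ n j i ⊎ Succ2 n i j ⊎ Succ2 n j i) → cyc j ∈ X

SepBy : (n : ℕ) → ℕ → VSet n → Vtx n → Vtx n → Set
SepBy n k L u v =
  Σ (Fin k → Vtx n) λ f → Injective _≡_ _≡_ f × (∀ j → f j ∈ L × Separates n (f j) u v)

SepByCyc : (n : ℕ) → ℕ → VSet n → Vtx n → Vtx n → Set
SepByCyc n k L u v =
  Σ (Fin k → Fin (n ∸ 1)) λ f → Injective _≡_ _≡_ f ×
    (∀ j → cyc (f j) ∈ L × Separates n (cyc (f j)) u v)

IsNL : (n : ℕ) → ℕ → VSet n → Set
IsNL n k L = ∀ u v → u ≢ v → u ∉ L → v ∉ L → SepBy n k L u v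

module Submission where

-- Parts 2 and 3 are about distances, which in a wheel take only three values:
-- the hub is at distance 1 from every cycle vertex, and two distinct,
-- non-adjacent cycle vertices are at distance 2 (through the hub).  Hence a
-- cycle vertex c_j that is not a cycle-neighbour of c_i separates h from c_i,
-- while the hub separates no two cycle vertices.  Discarding from k + 2
-- landmarks on the cycle the (at most one) successor and the (at most one)
-- predecessor of c_i leaves k separating landmarks (Part 2); and since the hub
-- never separates two cycle vertices, Part 2 lets us delete it from an
-- NL-landmark set (Part 3).  Neither part needs n ≥ 6 or k ∈ {3,4}.
--
-- Part 1 is a window count on the cycle of length N = n - 1.  Read positions
-- modulo N.  The condition on X says that among any three consecutive cycle
-- positions at most one is missing from X, so each of the N windows
-- {a, a+1, a+2} contains at least two members of X.  Summing over all windows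
-- counts every member exactly three times (the sum is shift invariant on a
-- cycle), whence 2N ≤ 3|X ∩ C| and |X ∩ C| ≥ ⌊2n/3⌋.  Finally a count of
-- members is turned into an injective enumeration of them.

open import Defs
open import Data.Nat using (ℕ; zero; suc; _+_; _*_; _∸_; _≤_; _<_; z≤n; s≤s; s≤s⁻¹;
  _≟_; NonZero)
import Data.Nat.Properties as ℕ
open import Data.Nat.DivMod using (_/_; _%_; _mod_; m≡m%n+[m/n]*n; [m+kn]%n≡m%n;
  [m+n]%n≡m%n; m%n<n; m<n⇒m%n≡m; n%n≡0; m<n*o⇒m/o<n)
open import Data.Fin as Fin using (Fin; toℕ; punchIn)
open import Data.Fin.Properties using (toℕ-injective; toℕ<n; toℕ-fromℕ<; fromℕ<-cong;
  punchIn-injective; punchInᵢ≢i; suc-injective; any?)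
open import Data.Bool using (Bool; true; false)
open import Data.Bool.Properties using (∧-identityʳ)
open import Data.Product using (Σ; _×_; _,_; proj₁; proj₂)
open import Data.Sum using (_⊎_; inj₁; inj₂)
open import Data.Empty using (⊥-elim)
open import Data.Unit using (tt)
open import Function using (_∘_)
open import Function.Definitions using (Injective)
open import Relation.Nullary using (¬_; Dec; yes; no)
open import Relation.Binary using (tri<; tri≈; tri>)
open import Relation.Binary.PropositionalEquality
  using (_≡_; _≢_; refl; sym; trans; cong; cong₂; subst; module ≡-Reasoning)
open import Algebra.Properties.CommutativeSemigroup ℕ.+-commutativeSemigroup
  using (interchange; xy∙z≈xz∙y)

dist-unique : ∀ {n} {u v : Vtx n} {a b} → Dist n u v a → Dist n u v b → a ≡ b
dist-unique {a = a} {b} (walk-a , min-a) (walk-b , min-b) with ℕ.<-cmp a b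
... | tri< a<b _ _ = ⊥-elim (min-b a a<b walk-a)
... | tri≈ _ a≡b _ = a≡b
... | tri> _ _ b<a = ⊥-elim (min-a b b<a walk-b)

no-walk₀ : ∀ {n} {u v : Vtx n} → u ≢ v → ¬ Walk n u v 0
no-walk₀ u≢v here = u≢v refl

no-walk₁ : ∀ {n} {u v : Vtx n} → ¬ Adj n u v → ¬ Walk n u v 1
no-walk₁ ¬adj (step adj here) = ¬adj adj

cyc-injective : ∀ {n} → Injective _≡_ _≡_ (cyc {n})
cyc-injective refl = refl

dist-refl : ∀ {n} (u : Vtx n) → Dist n u u 0
dist-refl u = here , λ _ ()

dist-hub-cyc : ∀ {n} j → Dist n hub (cyc j) 1
dist-hub-cyc j = step tt here , λ { zero _ → no-walk₀ λ () ; (suc _) (s≤s ()) }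

dist-cyc-hub : ∀ {n} j → Dist n (cyc j) hub 1
dist-cyc-hub j = step tt here , λ { zero _ → no-walk₀ λ () ; (suc _) (s≤s ()) }

dist-non-adjacent : ∀ {n} {i j : Fin (n ∸ 1)} → i ≢ j → ¬ Adj n (cyc i) (cyc j) →
  Dist n (cyc i) (cyc j) 2
dist-non-adjacent i≢j ¬adj = step {w = hub} tt (step tt here) , λ
  { zero _ → no-walk₀ (i≢j ∘ cyc-injective)
  ; (suc zero) _ → no-walk₁ ¬adj
  ; (suc (suc _)) (s≤s (s≤s ())) }

-- A cycle vertex that is not a cycle-neighbour of c_i separates h from c_i:
-- it is at distance 1 from h but at distance 0 or 2 from c_i.
cyc-separates-hub : ∀ {n} (i j : Fin (n ∸ 1)) → ¬ Adj n (cyc i) (cyc j) →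
  Separates n (cyc j) hub (cyc i)
cyc-separates-hub i j ¬adj with i Fin.≟ j
... | yes refl = 1 , 0 , dist-hub-cyc j , dist-refl (cyc j) , λ ()
... | no i≢j = 1 , 2 , dist-hub-cyc j , dist-non-adjacent i≢j ¬adj , λ ()

-- The hub is at distance 1 from every cycle vertex, so it separates none.
hub-separates-no-cycle-pair : ∀ {n} {i i' : Fin (n ∸ 1)} →
  ¬ Separates n hub (cyc i) (cyc i')
hub-separates-no-cycle-pair {i = i} {i'} (a , b , dist-a , dist-b , a≢b) =
  a≢b (trans (dist-unique dist-a (dist-cyc-hub i))
             (sym (dist-unique dist-b (dist-cyc-hub i'))))

Succ? : ∀ n i j → Dec (Succ n i j)
Succ? n i j with suc (toℕ i) ≟ toℕ j | suc (toℕ i) ≟ n ∸ 1 | toℕ j ≟ 0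
... | yes next   | _        | _         = yes (inj₁ next)
... | no ¬next   | yes last | yes first = yes (inj₂ (last , first))
... | no ¬next   | yes _    | no ¬first = no λ { (inj₁ s) → ¬next s ; (inj₂ (_ , f)) → ¬first f }
... | no ¬next   | no ¬last | _         = no λ { (inj₁ s) → ¬next s ; (inj₂ (l , _)) → ¬last l }

succ-unique-right : ∀ {n i x y} → Succ n i x → Succ n i y → x ≡ y
succ-unique-right {n} {i} {x} {y} sx sy = toℕ-injective (on-indices sx sy)
  where
  on-indices : Succ n i x → Succ n i y → toℕ x ≡ toℕ y
  on-indices (inj₁ p) (inj₁ q) = trans (sym p) q
  on-indices (inj₁ p) (inj₂ (q , _)) =
    ⊥-elim (ℕ.<-irrefl (trans (sym p) q) (toℕ<n x))
  on-indices (inj₂ (q , _)) (inj₁ p) =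
    ⊥-elim (ℕ.<-irrefl (trans (sym p) q) (toℕ<n y))
  on-indices (inj₂ (_ , p)) (inj₂ (_ , q)) = trans p (sym q)

succ-unique-left : ∀ {n i x y} → Succ n x i → Succ n y i → x ≡ y
succ-unique-left {n} {i} {x} {y} sx sy = toℕ-injective (on-indices sx sy)
  where
  on-indices : Succ n x i → Succ n y i → toℕ x ≡ toℕ y
  on-indices (inj₁ p) (inj₁ q) = ℕ.suc-injective (trans p (sym q))
  on-indices (inj₁ p) (inj₂ (_ , q)) with trans p q
  ... | ()
  on-indices (inj₂ (_ , q)) (inj₁ p) with trans p q
  ... | ()
  on-indices (inj₂ (p , _)) (inj₂ (q , _)) = ℕ.suc-injective (trans p (sym q))

drop-at-most-one : ∀ {A : Set} {t} (P Q : A → Set) → (∀ x → Dec (Q x)) →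
  (∀ {x y} → Q x → Q y → x ≡ y) →
  (f : Fin (suc t) → A) → Injective _≡_ _≡_ f → (∀ j → P (f j)) →
  Σ (Fin t → A) λ g → Injective _≡_ _≡_ g × (∀ j → P (g j) × ¬ Q (g j))
drop-at-most-one P Q Q? Q-unique f f-inj f-P with any? (Q? ∘ f)
... | yes (l , Q-fl) =
  f ∘ punchIn l ,
  (λ {x} {y} e → punchIn-injective l x y (f-inj e)) ,
  λ j → f-P (punchIn l j) , λ Q-fj → punchInᵢ≢i l j (f-inj (Q-unique Q-fj Q-fl))
... | no ¬Q = f ∘ Fin.suc , (λ e → suc-injective (f-inj e)) ,
  λ j → f-P (Fin.suc j) , λ Q-fj → ¬Q (Fin.suc j , Q-fj)

-- Discard the successor and the predecessor of c_i from k + 2 landmarks on the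
-- cycle; each of the remaining k is non-adjacent to c_i, hence separates h
-- from c_i.
hub-cycle-separated : ∀ n k (L : VSet n) → AtLeastCyc n (2 + k) L →
  ∀ i → SepByCyc n k L hub (cyc i)
hub-cycle-separated n k L (f , f-inj , f∈L) i
  with drop-at-most-one (λ x → cyc x ∈ L) (Succ n i) (Succ? n i)
         (succ-unique-right {n}) f f-inj f∈L
... | g , g-inj , g-spec
  with drop-at-most-one (λ x → cyc x ∈ L × ¬ Succ n i x) (λ x → Succ n x i)
         (λ x → Succ? n x i) (succ-unique-left {n}) g g-inj g-spec
... | h , h-inj , h-spec = h , h-inj , λ j →
  proj₁ (proj₁ (h-spec j)) , cyc-separates-hub i (h j) (non-adjacent j)
  where
  non-adjacent : ∀ j → ¬ Adj n (cyc i) (cyc (h j))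
  non-adjacent j (inj₁ succ) = proj₂ (proj₁ (h-spec j)) succ
  non-adjacent j (inj₂ pred) = proj₂ (h-spec j) pred

cyc∈removeHub : ∀ {n} (L : VSet n) x → cyc x ∈ L → cyc x ∈ removeHub L
cyc∈removeHub L x x∈L rewrite x∈L = refl

cyc∉removeHub : ∀ {n} (L : VSet n) x → cyc x ∉ removeHub L → cyc x ∉ L
cyc∉removeHub L x = trans (sym (∧-identityʳ (L (cyc x))))

separates-sym : ∀ {n} {τ u v : Vtx n} → Separates n τ u v → Separates n τ v u
separates-sym (a , b , dist-a , dist-b , a≢b) = b , a , dist-b , dist-a , a≢b ∘ sym

sepByCyc⇒sepBy : ∀ {n k} {L : VSet n} {u v} → SepByCyc n k L u v →
  SepBy n k (removeHub L) u v
sepByCyc⇒sepBy {L = L} (f , f-inj , f-spec) =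
  cyc ∘ f , f-inj ∘ cyc-injective ,
  λ j → cyc∈removeHub L (f j) (proj₁ (f-spec j)) , proj₂ (f-spec j)

-- Pairs involving the hub are handled by Part 2; pairs of cycle vertices are
-- never separated by the hub, so their separating landmarks avoid it.
remove-hub-NL : ∀ n k (L : VSet n) → (∀ i → SepByCyc n k L hub (cyc i)) →
  IsNL n k L → IsNL n k (removeHub L)
remove-hub-NL n k L hub-sep nl hub hub h≢h _ _ = ⊥-elim (h≢h refl)
remove-hub-NL n k L hub-sep nl hub (cyc i) _ _ _ = sepByCyc⇒sepBy {L = L} (hub-sep i)
remove-hub-NL n k L hub-sep nl (cyc i) hub _ _ _
  with sepByCyc⇒sepBy {L = L} (hub-sep i)
... | f , f-inj , f-spec = f , f-inj , λ j → proj₁ (f-spec j) , separates-sym (proj₂ (f-spec j))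
remove-hub-NL n k L hub-sep nl (cyc i) (cyc i') ci≢ci' ci∉ ci'∉
  with nl (cyc i) (cyc i') ci≢ci' (cyc∉removeHub L i ci∉) (cyc∉removeHub L i' ci'∉)
... | f , f-inj , f-spec = f , f-inj , λ j →
  avoids-hub (f j) (proj₁ (f-spec j)) (proj₂ (f-spec j)) , proj₂ (f-spec j)
  where
  avoids-hub : ∀ τ → τ ∈ L → Separates n τ (cyc i) (cyc i') → τ ∈ removeHub L
  avoids-hub hub _ sep = ⊥-elim (hub-separates-no-cycle-pair {n} sep)
  avoids-hub (cyc x) x∈L _ = cyc∈removeHub L x x∈L

sumBelow : ℕ → (ℕ → ℕ) → ℕ
sumBelow zero    f = 0
sumBelow (suc l) f = sumBelow l f + f l

sumBelow-shift : ∀ l f → sumBelow l (f ∘ suc) + f 0 ≡ sumBelow l f + f l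
sumBelow-shift zero    f = refl
sumBelow-shift (suc l) f = begin
  sumBelow l (f ∘ suc) + f (suc l) + f 0 ≡⟨ xy∙z≈xz∙y (sumBelow l (f ∘ suc)) _ _ ⟩
  sumBelow l (f ∘ suc) + f 0 + f (suc l) ≡⟨ cong (_+ f (suc l)) (sumBelow-shift l f) ⟩
  sumBelow l f + f l + f (suc l)         ∎
  where open ≡-Reasoning

sumBelow-rotate : ∀ l f → f l ≡ f 0 → sumBelow l (f ∘ suc) ≡ sumBelow l f
sumBelow-rotate l f period = ℕ.+-cancelʳ-≡ (f 0) _ _
  (trans (sumBelow-shift l f) (cong (sumBelow l f +_) period))

sumBelow-+ : ∀ l f g → sumBelow l (λ i → f i + g i) ≡ sumBelow l f + sumBelow l g
sumBelow-+ zero    f g = refl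
sumBelow-+ (suc l) f g =
  trans (cong (_+ (f l + g l)) (sumBelow-+ l f g))
        (interchange (sumBelow l f) (sumBelow l g) (f l) (g l))

sumBelow-lower : ∀ l c f → (∀ i → c ≤ f i) → l * c ≤ sumBelow l f
sumBelow-lower zero    c f c≤f = z≤n
sumBelow-lower (suc l) c f c≤f = subst (_≤ sumBelow (suc l) f) (ℕ.+-comm (l * c) c)
  (ℕ.+-mono-≤ (sumBelow-lower l c f c≤f) (c≤f l))

sumBelow-windows : ∀ l f → f l ≡ f 0 → f (suc l) ≡ f 1 →
  sumBelow l (λ i → f i + f (suc i) + f (suc (suc i))) ≡ 3 * sumBelow l f
sumBelow-windows l f period₀ period₁ = begin
  sumBelow l (λ i → f i + f (suc i) + f (suc (suc i)))
    ≡⟨ sumBelow-+ l (λ i → f i + f (suc i)) (f ∘ suc ∘ suc) ⟩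
  sumBelow l (λ i → f i + f (suc i)) + sumBelow l (f ∘ suc ∘ suc)
    ≡⟨ cong (_+ sumBelow l (f ∘ suc ∘ suc)) (sumBelow-+ l f (f ∘ suc)) ⟩
  S + sumBelow l (f ∘ suc) + sumBelow l (f ∘ suc ∘ suc)
    ≡⟨ cong₂ (λ x y → S + x + y) rotate₁ (trans rotate₂ rotate₁) ⟩
  S + S + S
    ≡⟨ ℕ.+-assoc S S S ⟩
  S + (S + S)
    ≡⟨ cong (λ x → S + (S + x)) (sym (ℕ.+-identityʳ S)) ⟩
  3 * S ∎
  where
  open ≡-Reasoning
  S : ℕ
  S = sumBelow l f
  rotate₁ : sumBelow l (f ∘ suc) ≡ S
  rotate₁ = sumBelow-rotate l f period₀
  rotate₂ : sumBelow l (f ∘ suc ∘ suc) ≡ sumBelow l (f ∘ suc)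
  rotate₂ = sumBelow-rotate l (f ∘ suc) period₁

indicator : Bool → ℕ
indicator true  = 1
indicator false = 0

count : (ℕ → Bool) → ℕ → ℕ
count q l = sumBelow l (indicator ∘ q)

enumerate : ∀ (q : ℕ → Bool) l t → t ≤ count q l →
  Σ (Fin t → ℕ) λ g → Injective _≡_ _≡_ g × (∀ j → g j < l × q (g j) ≡ true)
enumerate q l zero _ = (λ ()) , (λ { {()} }) , λ ()
enumerate q (suc l) (suc t) t<count with q l in ql
... | false with enumerate q l (suc t) (subst (suc t ≤_) (ℕ.+-identityʳ _) t<count)
...   | g , g-inj , g-spec = g , g-inj , λ j → ℕ.m<n⇒m<1+n (proj₁ (g-spec j)) , proj₂ (g-spec j)
enumerate q (suc l) (suc t) t<count | true
  with enumerate q l t (s≤s⁻¹ (subst (suc t ≤_) (ℕ.+-comm (count q l) 1) t<count))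
... | g , g-inj , g-spec = f , f-inj , f-spec
  where
  f : Fin (suc t) → ℕ
  f Fin.zero    = l
  f (Fin.suc j) = g j

  f-inj : Injective _≡_ _≡_ f
  f-inj {Fin.zero}  {Fin.zero}  _ = refl
  f-inj {Fin.zero}  {Fin.suc y} e = ⊥-elim (ℕ.<-irrefl (sym e) (proj₁ (g-spec y)))
  f-inj {Fin.suc x} {Fin.zero}  e = ⊥-elim (ℕ.<-irrefl e (proj₁ (g-spec x)))
  f-inj {Fin.suc x} {Fin.suc y} e = cong Fin.suc (g-inj e)

  f-spec : ∀ j → f j < suc l × q (f j) ≡ true
  f-spec Fin.zero    = ℕ.n<1+n l , ql
  f-spec (Fin.suc j) = ℕ.m<n⇒m<1+n (proj₁ (g-spec j)) , proj₂ (g-spec j)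

-- Position a ∈ ℕ on a cycle of length N is the cycle vertex a mod N; the wheel
-- with this cycle has suc N vertices.
module CyclePositions (N : ℕ) .{{_ : NonZero N}} where

  toℕ-mod : ∀ a → toℕ (a mod N) ≡ a % N
  toℕ-mod a = toℕ-fromℕ< (m%n<n a N)

  suc-% : ∀ a → suc a % N ≡ suc (a % N) % N
  suc-% a = trans (cong (λ x → suc x % N) (m≡m%n+[m/n]*n a N))
                  ([m+kn]%n≡m%n (suc (a % N)) (a / N) N)

  mod-succ : ∀ a → Succ (suc N) (a mod N) (suc a mod N)
  mod-succ a with ℕ.m≤n⇒m<n∨m≡n (m%n<n a N)
  ... | inj₁ inside = inj₁ (begin
    suc (toℕ (a mod N)) ≡⟨ cong suc (toℕ-mod a) ⟩
    suc (a % N)         ≡⟨ sym (m<n⇒m%n≡m inside) ⟩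
    suc (a % N) % N     ≡⟨ sym (suc-% a) ⟩
    suc a % N           ≡⟨ sym (toℕ-mod (suc a)) ⟩
    toℕ (suc a mod N)   ∎)
    where open ≡-Reasoning
  ... | inj₂ wraps = inj₂ (trans (cong suc (toℕ-mod a)) wraps , (begin
    toℕ (suc a mod N)   ≡⟨ toℕ-mod (suc a) ⟩
    suc a % N           ≡⟨ suc-% a ⟩
    suc (a % N) % N     ≡⟨ cong (_% N) wraps ⟩
    N % N               ≡⟨ n%n≡0 N ⟩
    0                   ∎))
    where open ≡-Reasoning

  mod-periodic : ∀ a → (a + N) mod N ≡ a mod N
  mod-periodic a = fromℕ<-cong _ _ ([m+n]%n≡m%n a N) _ _

  mod-injective-below : ∀ {a b} → a < N → b < N → a mod N ≡ b mod N → a ≡ b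
  mod-injective-below {a} {b} a<N b<N e = begin
    a           ≡⟨ sym (m<n⇒m%n≡m a<N) ⟩
    a % N       ≡⟨ sym (toℕ-mod a) ⟩
    toℕ (a mod N) ≡⟨ cong toℕ e ⟩
    toℕ (b mod N) ≡⟨ toℕ-mod b ⟩
    b % N       ≡⟨ m<n⇒m%n≡m b<N ⟩
    b           ∎
    where open ≡-Reasoning

two-of-three : ∀ x y z → (x ≡ false → y ≡ true × z ≡ true) → (y ≡ false → z ≡ true) →
  2 ≤ indicator x + indicator y + indicator z
two-of-three false _ _ x-out _ with x-out refl
... | refl , refl = ℕ.≤-refl
two-of-three true false _ _ y-out with y-out refl
... | refl = ℕ.≤-refl
two-of-three true true _ _ _ = s≤s (s≤s z≤n)

module WindowCount (N : ℕ) .{{_ : NonZero N}} (X : VSet (suc N))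
                   (cond : CondX (suc N) X) where
  open CyclePositions N

  member : ℕ → Bool
  member a = X (cyc (a mod N))

  -- The condition on X leaves at most one gap in every window of three
  -- consecutive cycle positions.
  window : ∀ a → 2 ≤ indicator (member a) + indicator (member (suc a))
                     + indicator (member (suc (suc a)))
  window a = two-of-three _ _ _
    (λ gap → cond _ gap _ (inj₁ (mod-succ a)) ,
             cond _ gap _ (inj₂ (inj₂ (inj₁ (suc a mod N , mod-succ a , mod-succ (suc a))))))
    (λ gap → cond _ gap _ (inj₁ (mod-succ (suc a))))

  two-thirds : 2 * N ≤ 3 * count member N
  two-thirds = begin
    2 * N ≡⟨ ℕ.*-comm 2 N ⟩
    N * 2 ≤⟨ sumBelow-lower N 2 _ window ⟩
    sumBelow N (λ i → f i + f (suc i) + f (suc (suc i)))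
      ≡⟨ sumBelow-windows N f (cong (indicator ∘ X ∘ cyc) (mod-periodic 0))
                              (cong (indicator ∘ X ∘ cyc) (mod-periodic 1)) ⟩
    3 * count member N ∎
    where
    open ℕ.≤-Reasoning
    f : ℕ → ℕ
    f = indicator ∘ member

div-bound : ∀ N t → 2 * N ≤ 3 * t → (2 * suc N) / 3 ≤ t
div-bound N t 2N≤3t = s≤s⁻¹ (m<n*o⇒m/o<n (begin-strict
  2 * suc N ≡⟨ ℕ.*-suc 2 N ⟩
  2 + 2 * N <⟨ ℕ.n<1+n _ ⟩
  3 + 2 * N ≤⟨ ℕ.+-monoʳ-≤ 3 2N≤3t ⟩
  3 + 3 * t ≡⟨ sym (ℕ.*-suc 3 t) ⟩
  3 * suc t ≡⟨ ℕ.*-comm 3 (suc t) ⟩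
  suc t * 3 ∎))
  where open ℕ.≤-Reasoning

cond-two-thirds : ∀ m (X : VSet (2 + m)) → CondX (2 + m) X →
  AtLeastCyc (2 + m) ((2 * (2 + m)) / 3) X
cond-two-thirds m X cond =
  read-mod-N (enumerate member N _ (div-bound N (count member N) two-thirds))
  where
  N : ℕ
  N = suc m
  open CyclePositions N
  open WindowCount N X cond

  read-mod-N : Σ (Fin ((2 * suc N) / 3) → ℕ) (λ g →
      Injective _≡_ _≡_ g × (∀ j → g j < N × member (g j) ≡ true)) →
    AtLeastCyc (suc N) ((2 * suc N) / 3) X
  read-mod-N (g , g-inj , g-spec) =
    (λ j → g j mod N) ,
    (λ e → g-inj (mod-injective-below (proj₁ (g-spec _)) (proj₁ (g-spec _)) e)) ,
    (λ j → proj₂ (g-spec j))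

mainTheorem18 : (n : ℕ) → 6 ≤ n → (k : ℕ) → (k ≡ 3 ⊎ k ≡ 4) →
    (∀ (X : VSet n) → CondX n X → AtLeastCyc n ((2 * n) / 3) X)
    × (∀ (L : VSet n) → AtLeastCyc n (k + 2) L →
         (∀ i → SepByCyc n k L hub (cyc i))
         × (IsNL n k L → IsNL n k (removeHub L)))
mainTheorem18 n@(suc (suc m)) (s≤s (s≤s _)) k _ = cond-two-thirds m , λ L many-landmarks →
  let hub-separated = hub-cycle-separated n k L
        (subst (λ r → AtLeastCyc n r L) (ℕ.+-comm k 2) many-landmarks)
  in hub-separated , remove-hub-NL n k L hub-separated
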